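{- Let $k\ge 2$ and let $B_k$ be the binomial tree with $2^{k-1}$ vertices. Then the depth of $B_k$ produced by Algorithm 1 is $d(B_k)=k-1$.
   Context: The rooted binomial tree $B_k$ is defined recursively: $B_1$ is a single vertex (its root); for $k>1$, $B_k$ consists of two disjoint copies of $B_{k-1}$ together with an edge joining their roots, the root of $B_k$ being the root of the first copy. For a tree $T$, an edge $e$ is balanced if the absolute difference of the numbers of edges of the two components of $T-e$ is minimum among all edges of $T$. Algorithm 1: start with the forest $F=T$. While $F$ has a component with more than one vertex, perform an iteration: simultaneously, from each component of $F$ with more than one vertex, delete one balanced edge (balanced with respect to that component); an edge deleted in the $i$-th iteration is colored $i$. The depth $d(T)$ is the number of iterations performed. -}

module Defs where

open import Data.Nat using (ℕ; zero; suc; _+_; _^_; _≤_; ∣_-_∣)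
open import Data.Nat.Properties using () renaming (_≟_ to _≟ℕ_)
open import Data.Product using (_×_; _,_; proj₁; proj₂; ∃; ∃-syntax; Σ)
open import Data.Product.Properties using (≡-dec)
open import Data.Sum using (_⊎_)
open import Data.List using (List; []; _∷_; _++_; map; filter; length)
open import Data.List.Membership.Propositional using (_∈_; _∉_)
open import Data.List.Relation.Unary.Unique.Propositional using (Unique)
open import Relation.Binary.Construct.Closure.ReflexiveTransitive using (Star)
open import Relation.Binary.PropositionalEquality using (_≡_)
open import Relation.Binary.Definitions using (DecidableEquality)
open import Relation.Nullary using (¬_; ¬?)
import Data.List.Membership.DecPropositional as DecMem

-- Vertices are natural numbers; an edge is an ordered pair of vertices
-- (read as an undirected edge); a graph/forest is given by its list of edges.
Edge : Set
Edge = ℕ × ℕ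

Graph : Set
Graph = List Edge

_≟ₑ_ : DecidableEquality Edge
_≟ₑ_ = ≡-dec _≟ℕ_ _≟ℕ_

open DecMem _≟ₑ_ using (_∈?_)

-- Binomial tree.  binEdges j is the edge list of B_(j+1), on vertex set
-- {0, …, 2^j - 1} with root 0.  B_(j+2) = copy of B_(j+1) on {0..2^j-1},
-- copy shifted by 2^j, and the edge joining the roots 0 and 2^j.
shiftE : ℕ → Edge → Edge
shiftE s (u , v) = (s + u , s + v)

binEdges : ℕ → Graph
binEdges zero = []
binEdges (suc j) = binEdges j ++ ((0 , 2 ^ j) ∷ map (shiftE (2 ^ j)) (binEdges j))

B : ℕ → Graph
B zero = []          -- unused (k ≥ 1 in the paper)
B (suc j) = binEdges j

Adj : Graph → ℕ → ℕ → Set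
Adj G u v = ((u , v) ∈ G) ⊎ ((v , u) ∈ G)

Conn : Graph → ℕ → ℕ → Set
Conn G = Star (Adj G)

CompEdges : Graph → ℕ → Graph → Set
CompEdges G a L =
  Unique L × (∀ e → (e ∈ L → (e ∈ G × Conn G a (proj₁ e))) × ((e ∈ G × Conn G a (proj₁ e)) → e ∈ L))

removeE : Edge → Graph → Graph
removeE e G = filter (λ f → ¬? (f ≟ₑ e)) G

removeAll : Graph → Graph → Graph
removeAll S G = filter (λ f → ¬? (f ∈? S)) G

Imb : Graph → Edge → ℕ → Set
Imb G (a , b) d =
  ∃[ L₁ ] ∃[ L₂ ] (CompEdges (removeE (a , b) G) a L₁ × CompEdges (removeE (a , b) G) b L₂
                    × d ≡ ∣ length L₁ - length L₂ ∣)

Balanced : Graph → Edge → Set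
Balanced C e = e ∈ C × ∃[ d ] (Imb C e d × (∀ e' d' → e' ∈ C → Imb C e' d' → d ≤ d'))

-- S is a valid set of edges to delete in one iteration from the forest F:
-- every deleted edge is balanced with respect to its component of F, and
-- every component of F with more than one vertex (i.e. containing an edge)
-- contains exactly one deleted edge.
ValidDeletion : Graph → Graph → Set
ValidDeletion F S =
  (∀ s → s ∈ S → ∀ C → CompEdges F (proj₁ s) C → Balanced C s)
  × (∀ e → e ∈ F → ∃[ s ] (s ∈ S × Conn F (proj₁ e) (proj₁ s)))
  × (∀ s s' → s ∈ S → s' ∈ S → Conn F (proj₁ s) (proj₁ s') → s ≡ s')

-- Run F n : some execution of Algorithm 1 starting from forest F performs
-- exactly n iterations.
data Run : Graph → ℕ → Set where
  done : Run [] 0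
  step : ∀ {F n} (S : Graph) → (∃[ e ] (e ∈ F)) → ValidDeletion F S
       → Run (removeAll S F) n → Run F (suc n)

module Submission where

-- Write BT b m for the binomial tree of order m laid out on the vertex
-- interval [b, b + 2^m) with root b: BT b 0 has no edges, and BT b (m+1)
-- consists of BT b m, BT (b + 2^m) m and the bridge (b , b + 2^m).  Thus
-- B_(m+1) = BT 0 m.  A block forest of order m with N blocks is the union
-- of the trees BT (c * 2^m) m for c < N.
--
-- Deleting the bridge of BT b (m+1) leaves two halves with
--    2^m - 1 edges each (imbalance 0).  Deleting any other edge e leaves one
--    side containing the whole other half and the bridge, and the other side
--    inside the half of e minus e, so the imbalance is positive.  Hence the
--    bridge is the unique balanced edge.
-- 2. Block forests.  The components of a block forest are its blocks, so
--    every valid deletion in a block forest of order m+1 with N blocks removes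
--    exactly the N bridges, leaving the block forest of order m with 2N blocks.
-- 3. By induction on m, every run of Algorithm 1 on a block forest of order m
--    has exactly m iterations, and such a run exists; B_k is the block forest
--    of order k - 1 with one block.

open import Defs
open import Data.Nat using (ℕ; zero; suc; _+_; _*_; _^_; _≤_; _<_; _∸_; z≤n; s≤s; _<?_; NonZero; >-nonZero)
open import Data.Nat.DivMod using (_/_; _%_; m/n*n≤m; m≡m%n+[m/n]*n; m%n<n)
open import Data.Nat.Properties
open import Data.Product using (_×_; _,_; proj₁; proj₂; ∃-syntax)
open import Data.Sum using (_⊎_; inj₁; inj₂)
import Data.Sum as Sum
open import Data.List using ([]; _∷_; _++_; map; length; applyUpTo)
open import Data.List.Properties using (length-++; length-filter; map-++)
open import Data.List.Membership.Propositional using (_∈_; _∉_)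
open import Data.List.Membership.Propositional.Properties using (∈-++⁺ˡ; ∈-++⁺ʳ; ∈-++⁻; ∈-filter⁺; ∈-filter⁻; ∈-applyUpTo⁺; ∈-applyUpTo⁻)
open import Data.List.Relation.Binary.Subset.Propositional using (_⊆_)
open import Data.List.Relation.Unary.Any using (here; there)
open import Data.List.Relation.Unary.All using (tabulate; lookup)
open import Data.List.Relation.Unary.AllPairs using ([]; _∷_)
open import Data.List.Relation.Unary.Unique.Propositional using (Unique)
open import Data.List.Relation.Unary.Unique.Propositional.Properties using (++⁺)
open import Relation.Binary.Construct.Closure.ReflexiveTransitive using (ε; _◅_; _◅◅_)
import Relation.Binary.Construct.Closure.ReflexiveTransitive as Star
open import Relation.Binary.PropositionalEquality using (_≡_; _≢_; refl; sym; trans; cong; cong₂; subst; subst₂; module ≡-Reasoning)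
open import Relation.Binary.Definitions using (tri<; tri≈; tri>)
open import Relation.Nullary using (¬_; ¬?; yes; no; contradiction)
open import Data.Empty using (⊥-elim)
open import Function using (_∘_; id)

adj-sym : ∀ {G x y} → Adj G x y → Adj G y x
adj-sym (inj₁ e) = inj₂ e
adj-sym (inj₂ e) = inj₁ e

conn-sym : ∀ {G x y} → Conn G x y → Conn G y x
conn-sym = Star.reverse adj-sym

conn-mono : ∀ {G H} → G ⊆ H → ∀ {x y} → Conn G x y → Conn H x y
conn-mono G⊆H = Star.map (Sum.map G⊆H G⊆H)

conn-collapse : ∀ {G H} (f : ℕ → ℕ) → (∀ {a c} → (a , c) ∈ G → (f a , f c) ∈ H ⊎ f a ≡ f c)
              → ∀ {x y} → Conn G x y → Conn H (f x) (f y)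
conn-collapse {G} {H} f image = Star.concat ∘ Star.gmap f edge-image
  where
  edge-image : ∀ {a c} → Adj G a c → Conn H (f a) (f c)
  edge-image (inj₁ e) with image e
  ... | inj₁ e′ = inj₁ e′ ◅ ε
  ... | inj₂ eq = subst (Conn H _) eq ε
  edge-image (inj₂ e) with image e
  ... | inj₁ e′ = inj₂ e′ ◅ ε
  ... | inj₂ eq = subst (Conn H _) (sym eq) ε

EdgeInvariant : Graph → (ℕ → Set) → Set
EdgeInvariant G P = ∀ {a c} → (a , c) ∈ G → (P a → P c) × (P c → P a)

conn-invariant : ∀ {G} (P : ℕ → Set) → EdgeInvariant G P → ∀ {x y} → Conn G x y → P x → P y
conn-invariant {G} P inv = Star.fold (λ x y → P x → P y) across id
  where
  across : ∀ {a c d} → Adj G a c → (P c → P d) → P a → P d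
  across (inj₁ e) k = k ∘ proj₁ (inv e)
  across (inj₂ e) k = k ∘ proj₂ (inv e)

∈-removeE⁺ : ∀ {s e G} → e ∈ G → e ≢ s → e ∈ removeE s G
∈-removeE⁺ {s} = ∈-filter⁺ (λ f → ¬? (f ≟ₑ s))

∈-removeE⁻ : ∀ {s e G} → e ∈ removeE s G → e ∈ G × e ≢ s
∈-removeE⁻ {s} = ∈-filter⁻ (λ f → ¬? (f ≟ₑ s))

module _ {S : Graph} where
  open import Data.List.Membership.DecPropositional _≟ₑ_ using (_∈?_)

  ∈-removeAll⁺ : ∀ {e G} → e ∈ G → e ∉ S → e ∈ removeAll S G
  ∈-removeAll⁺ = ∈-filter⁺ (λ f → ¬? (f ∈? S))

  ∈-removeAll⁻ : ∀ {e G} → e ∈ removeAll S G → e ∈ G × e ∉ S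
  ∈-removeAll⁻ = ∈-filter⁻ (λ f → ¬? (f ∈? S))

conn-removeE : ∀ {G u v x y} → Conn G x y →
  Conn (removeE (u , v) G) x y ⊎ Conn (removeE (u , v) G) x u ⊎ Conn (removeE (u , v) G) x v
conn-removeE ε = inj₁ ε
conn-removeE {u = u} {v} {x} (_◅_ {j = z} (inj₁ e) path) with (x , z) ≟ₑ (u , v)
... | yes refl = inj₂ (inj₁ ε)
... | no ne = Sum.map (inj₁ (∈-removeE⁺ e ne) ◅_) (Sum.map (inj₁ (∈-removeE⁺ e ne) ◅_) (inj₁ (∈-removeE⁺ e ne) ◅_))
                      (conn-removeE path)
conn-removeE {u = u} {v} {x} (_◅_ {j = z} (inj₂ e) path) with (z , x) ≟ₑ (u , v)
... | yes refl = inj₂ (inj₂ ε)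
... | no ne = Sum.map (inj₂ (∈-removeE⁺ e ne) ◅_) (Sum.map (inj₂ (∈-removeE⁺ e ne) ◅_) (inj₂ (∈-removeE⁺ e ne) ◅_))
                      (conn-removeE path)

length-removeE : ∀ {x} (M : Graph) → x ∈ M → suc (length (removeE x M)) ≤ length M
length-removeE {x} (y ∷ M) x∈ with y ≟ₑ x
length-removeE (y ∷ M) x∈ | yes refl = s≤s (length-filter (λ f → ¬? (f ≟ₑ y)) M)
length-removeE (y ∷ M) (here refl) | no y≢x = contradiction refl y≢x
length-removeE (y ∷ M) (there x∈) | no y≢x = s≤s (length-removeE M x∈)

unique-length-≤ : ∀ {L M : Graph} → Unique L → L ⊆ M → length L ≤ length M
unique-length-≤ {[]} _ _ = z≤n
unique-length-≤ {x ∷ L} {M} (x∉L ∷ uniqueL) L⊆M =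
  ≤-trans (s≤s (unique-length-≤ uniqueL L⊆removeE)) (length-removeE M (L⊆M (here refl)))
  where
  L⊆removeE : L ⊆ removeE x M
  L⊆removeE e∈L = ∈-removeE⁺ (L⊆M (there e∈L)) (λ eq → lookup x∉L e∈L (sym eq))

BT : ℕ → ℕ → Graph
BT b zero = []
BT b (suc p) = BT b p ++ ((b , b + 2 ^ p) ∷ BT (b + 2 ^ p) p)

InRange : ℕ → ℕ → ℕ → Set
InRange b m x = b ≤ x × x < b + 2 ^ m

2^-pos : ∀ p → 0 < 2 ^ p
2^-pos = m^n>0 2

halves-end : ∀ b p → b + 2 ^ p + 2 ^ p ≡ b + 2 ^ suc p
halves-end b p = trans (+-assoc b (2 ^ p) (2 ^ p)) (cong (λ t → b + (2 ^ p + t)) (sym (+-identityʳ (2 ^ p))))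

root<mid : ∀ b p → b < b + 2 ^ p
root<mid b p = m<m+n b (2^-pos p)

mid<end : ∀ b p → b + 2 ^ p < b + 2 ^ suc p
mid<end b p = subst (b + 2 ^ p <_) (halves-end b p) (m<m+n (b + 2 ^ p) (2^-pos p))

lower-range : ∀ b p {x} → InRange b p x → InRange b (suc p) x
lower-range b p (b≤x , x<mid) = b≤x , <-trans x<mid (mid<end b p)

upper-range : ∀ b p {x} → InRange (b + 2 ^ p) p x → InRange b (suc p) x
upper-range b p {x} (mid≤x , x<end) = ≤-trans (m≤m+n b (2 ^ p)) mid≤x , subst (x <_) (halves-end b p) x<end

data Half (b p : ℕ) : Edge → Set where
  lower  : ∀ {e} → e ∈ BT b p → Half b p e
  middle : Half b p (b , b + 2 ^ p)
  upper  : ∀ {e} → e ∈ BT (b + 2 ^ p) p → Half b p e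

half : ∀ b p {e} → e ∈ BT b (suc p) → Half b p e
half b p e∈ with ∈-++⁻ (BT b p) e∈
... | inj₁ e∈L = lower e∈L
... | inj₂ (here refl) = middle
... | inj₂ (there e∈U) = upper e∈U

lower⁺ : ∀ b p {e} → e ∈ BT b p → e ∈ BT b (suc p)
lower⁺ b p = ∈-++⁺ˡ

middle⁺ : ∀ b p → (b , b + 2 ^ p) ∈ BT b (suc p)
middle⁺ b p = ∈-++⁺ʳ (BT b p) (here refl)

upper⁺ : ∀ b p {e} → e ∈ BT (b + 2 ^ p) p → e ∈ BT b (suc p)
upper⁺ b p = ∈-++⁺ʳ (BT b p) ∘ there

BT-range : ∀ b m {x y} → (x , y) ∈ BT b m → InRange b m x × InRange b m y
BT-range b (suc p) e∈ with half b p e∈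
... | lower e∈L = let x∈ , y∈ = BT-range b p e∈L in lower-range b p x∈ , lower-range b p y∈
... | middle = (≤-refl , <-trans (root<mid b p) (mid<end b p)) , (m≤m+n b (2 ^ p) , mid<end b p)
... | upper e∈U = let x∈ , y∈ = BT-range (b + 2 ^ p) p e∈U in upper-range b p x∈ , upper-range b p y∈

BT-src : ∀ b m {x y} → (x , y) ∈ BT b m → InRange b m x
BT-src b m = proj₁ ∘ BT-range b m

BT-tgt : ∀ b m {x y} → (x , y) ∈ BT b m → InRange b m y
BT-tgt b m = proj₂ ∘ BT-range b m

BT-root-conn : ∀ b m {x} → InRange b m x → Conn (BT b m) b x
BT-root-conn b zero {x} (b≤x , x<b+1) rewrite ≤-antisym (m<1+n⇒m≤n (subst (x <_) (+-comm b 1) x<b+1)) b≤x = ε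
BT-root-conn b (suc p) {x} (b≤x , x<end) with x <? b + 2 ^ p
... | yes x<mid = conn-mono (lower⁺ b p) (BT-root-conn b p (b≤x , x<mid))
... | no x≮mid = inj₁ (middle⁺ b p) ◅ conn-mono (upper⁺ b p)
                   (BT-root-conn (b + 2 ^ p) p (≮⇒≥ x≮mid , subst (x <_) (sym (halves-end b p)) x<end))

BT-conn : ∀ b m {x y} → InRange b m x → InRange b m y → Conn (BT b m) x y
BT-conn b m x∈ y∈ = conn-sym (BT-root-conn b m x∈) ◅◅ BT-root-conn b m y∈

bridge∉lower : ∀ b p {e} → e ∈ BT b p → (b , b + 2 ^ p) ≢ e
bridge∉lower b p {_ , _} e∈L refl = n≮n _ (proj₂ (BT-tgt b p e∈L))

bridge∉upper : ∀ b p {e} → e ∈ BT (b + 2 ^ p) p → (b , b + 2 ^ p) ≢ e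
bridge∉upper b p {_ , _} e∈U refl = <⇒≱ (root<mid b p) (proj₁ (BT-src (b + 2 ^ p) p e∈U))

BT-unique : ∀ b m → Unique (BT b m)
BT-unique b zero = []
BT-unique b (suc p) = ++⁺ (BT-unique b p) (tabulate (bridge∉upper b p) ∷ BT-unique (b + 2 ^ p) p) disjoint
  where
  disjoint : ∀ {e} → ¬ (e ∈ BT b p × e ∈ ((b , b + 2 ^ p) ∷ BT (b + 2 ^ p) p))
  disjoint (e∈L , here refl) = bridge∉lower b p e∈L refl
  disjoint {_ , _} (e∈L , there e∈U) = <⇒≱ (proj₂ (BT-src b p e∈L)) (proj₁ (BT-src (b + 2 ^ p) p e∈U))

BT-size : ∀ b m → suc (length (BT b m)) ≡ 2 ^ m
BT-size b zero = refl
BT-size b (suc p) = begin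
  suc (length (BT b p ++ ((b , b + 2 ^ p) ∷ BT (b + 2 ^ p) p)))
    ≡⟨ cong suc (length-++ (BT b p)) ⟩
  suc (length (BT b p)) + suc (length (BT (b + 2 ^ p) p))
    ≡⟨ cong₂ _+_ (BT-size b p) (BT-size (b + 2 ^ p) p) ⟩
  2 ^ p + 2 ^ p
    ≡⟨ cong (2 ^ p +_) (sym (+-identityʳ (2 ^ p))) ⟩
  2 ^ suc p ∎
  where open ≡-Reasoning

BT-size-shift : ∀ b b′ m → length (BT b m) ≡ length (BT b′ m)
BT-size-shift b b′ m = suc-injective (trans (BT-size b m) (sym (BT-size b′ m)))

-- Apart from the bridge, no edge of BT b (suc p) crosses the midpoint, so
-- after deleting the bridge the two halves are not joined.
below-mid-invariant : ∀ b p → EdgeInvariant (removeE (b , b + 2 ^ p) (BT b (suc p))) (_< b + 2 ^ p)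
below-mid-invariant b p e∈ with ∈-removeE⁻ e∈
... | e∈G , e≢bridge with half b p e∈G
... | lower e∈L = (λ _ → proj₂ (BT-tgt b p e∈L)) , (λ _ → proj₂ (BT-src b p e∈L))
... | middle = contradiction refl e≢bridge
... | upper e∈U = (λ a<mid → contradiction (proj₁ (BT-src _ p e∈U)) (<⇒≱ a<mid))
                , (λ c<mid → contradiction (proj₁ (BT-tgt _ p e∈U)) (<⇒≱ c<mid))

below-mid-closed : ∀ b p {x y} → Conn (removeE (b , b + 2 ^ p) (BT b (suc p))) x y → x < b + 2 ^ p → y < b + 2 ^ p
below-mid-closed b p = conn-invariant (_< b + 2 ^ p) (below-mid-invariant b p)

above-mid-closed : ∀ b p {x y} → Conn (removeE (b , b + 2 ^ p) (BT b (suc p))) x y → b + 2 ^ p ≤ x → b + 2 ^ p ≤ y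
above-mid-closed b p path mid≤x = ≮⇒≥ (λ y<mid → <⇒≱ (below-mid-closed b p (conn-sym path) y<mid) mid≤x)

keepBelow : ℕ → ℕ → ℕ → ℕ
keepBelow K r x with x <? K
... | yes _ = x
... | no _ = r

keepBelow-< : ∀ {K r x} → x < K → keepBelow K r x ≡ x
keepBelow-< {K} {r} {x} x<K with x <? K
... | yes _ = refl
... | no x≮K = contradiction x<K x≮K

keepBelow-≥ : ∀ {K r x} → K ≤ x → keepBelow K r x ≡ r
keepBelow-≥ {K} {r} {x} K≤x with x <? K
... | yes x<K = contradiction K≤x (<⇒≱ x<K)
... | no _ = refl

keepAbove : ℕ → ℕ → ℕ → ℕ
keepAbove K r x with x <? K
... | yes _ = r
... | no _ = x

keepAbove-< : ∀ {K r x} → x < K → keepAbove K r x ≡ r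
keepAbove-< {K} {r} {x} x<K with x <? K
... | yes _ = refl
... | no x≮K = contradiction x<K x≮K

keepAbove-≥ : ∀ {K r x} → K ≤ x → keepAbove K r x ≡ x
keepAbove-≥ {K} {r} {x} K≤x with x <? K
... | yes x<K = contradiction K≤x (<⇒≱ x<K)
... | no _ = refl

-- Collapsing the upper half and the bridge onto the root turns a path that
-- avoids a lower edge e into a path in the lower half that avoids e.
collapse-upper : ∀ b p {u v} → (u , v) ∈ BT b p →
  Conn (removeE (u , v) (BT b (suc p))) u v → Conn (removeE (u , v) (BT b p)) u v
collapse-upper b p {u} {v} e∈L path =
  subst₂ (Conn _) (keepBelow-< (proj₂ (BT-src b p e∈L))) (keepBelow-< (proj₂ (BT-tgt b p e∈L)))
         (conn-collapse f image path)
  where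
  f : ℕ → ℕ
  f = keepBelow (b + 2 ^ p) b
  image : ∀ {a c} → (a , c) ∈ removeE (u , v) (BT b (suc p)) → (f a , f c) ∈ removeE (u , v) (BT b p) ⊎ f a ≡ f c
  image a∈ with ∈-removeE⁻ a∈
  ... | a∈G , a≢e with half b p a∈G
  ... | lower a∈L = inj₁ (subst₂ (λ s t → (s , t) ∈ removeE (u , v) (BT b p))
                          (sym (keepBelow-< (proj₂ (BT-src b p a∈L)))) (sym (keepBelow-< (proj₂ (BT-tgt b p a∈L))))
                          (∈-removeE⁺ a∈L a≢e))
  ... | middle = inj₂ (trans (keepBelow-< (root<mid b p)) (sym (keepBelow-≥ (≤-refl {b + 2 ^ p}))))
  ... | upper a∈U = inj₂ (trans (keepBelow-≥ (proj₁ (BT-src _ p a∈U))) (sym (keepBelow-≥ (proj₁ (BT-tgt _ p a∈U)))))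

-- Symmetrically, collapsing the lower half and the bridge onto the midpoint.
collapse-lower : ∀ b p {u v} → (u , v) ∈ BT (b + 2 ^ p) p →
  Conn (removeE (u , v) (BT b (suc p))) u v → Conn (removeE (u , v) (BT (b + 2 ^ p) p)) u v
collapse-lower b p {u} {v} e∈U path =
  subst₂ (Conn _) (keepAbove-≥ (proj₁ (BT-src _ p e∈U))) (keepAbove-≥ (proj₁ (BT-tgt _ p e∈U)))
         (conn-collapse f image path)
  where
  f : ℕ → ℕ
  f = keepAbove (b + 2 ^ p) (b + 2 ^ p)
  image : ∀ {a c} → (a , c) ∈ removeE (u , v) (BT b (suc p)) → (f a , f c) ∈ removeE (u , v) (BT (b + 2 ^ p) p) ⊎ f a ≡ f c
  image a∈ with ∈-removeE⁻ a∈
  ... | a∈G , a≢e with half b p a∈G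
  ... | lower a∈L = inj₂ (trans (keepAbove-< (proj₂ (BT-src b p a∈L))) (sym (keepAbove-< (proj₂ (BT-tgt b p a∈L)))))
  ... | middle = inj₂ (trans (keepAbove-< (root<mid b p)) (sym (keepAbove-≥ (≤-refl {b + 2 ^ p}))))
  ... | upper a∈U = inj₁ (subst₂ (λ s t → (s , t) ∈ removeE (u , v) (BT (b + 2 ^ p) p))
                          (sym (keepAbove-≥ (proj₁ (BT-src _ p a∈U)))) (sym (keepAbove-≥ (proj₁ (BT-tgt _ p a∈U))))
                          (∈-removeE⁺ a∈U a≢e))

BT-acyclic : ∀ b m {u v} → (u , v) ∈ BT b m → ¬ Conn (removeE (u , v) (BT b m)) u v
BT-acyclic b (suc p) e∈ path with half b p e∈
... | lower e∈L = BT-acyclic b p e∈L (collapse-upper b p e∈L path)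
... | middle = n≮n _ (below-mid-closed b p path (root<mid b p))
... | upper e∈U = BT-acyclic (b + 2 ^ p) p e∈U (collapse-lower b p e∈U path)

SameEdges : Graph → Graph → Set
SameEdges G H = G ⊆ H × H ⊆ G

removeE-same : ∀ {G H} s → SameEdges G H → SameEdges (removeE s G) (removeE s H)
removeE-same s (G⊆H , H⊆G) = keep G⊆H , keep H⊆G
  where
  keep : ∀ {A C} → A ⊆ C → removeE s A ⊆ removeE s C
  keep A⊆C e∈ = let e∈A , e≢s = ∈-removeE⁻ e∈ in ∈-removeE⁺ (A⊆C e∈A) e≢s

compEdges-same : ∀ {G H a L} → SameEdges G H → CompEdges G a L → CompEdges H a L
compEdges-same (G⊆H , H⊆G) (uniqueL , char) = uniqueL , λ e →
  (λ e∈L → let e∈G , path = proj₁ (char e) e∈L in G⊆H e∈G , conn-mono G⊆H path) ,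
  (λ (e∈H , path) → proj₂ (char e) (H⊆G e∈H , conn-mono H⊆G path))

imb-same : ∀ {G H e d} → SameEdges G H → Imb G e d → Imb H e d
imb-same {e = e} same (L₁ , L₂ , comp₁ , comp₂ , d≡) =
  L₁ , L₂ , compEdges-same (removeE-same e same) comp₁ , compEdges-same (removeE-same e same) comp₂ , d≡

BT-component : ∀ {G a} b m → InRange b m a → BT b m ⊆ G
             → (∀ {x y} → (x , y) ∈ G → Conn G a x → (x , y) ∈ BT b m) → CompEdges G a (BT b m)
BT-component b m a∈ BT⊆G closed = BT-unique b m , λ { (x , y) →
  (λ e∈ → BT⊆G e∈ , conn-mono BT⊆G (BT-conn b m a∈ (BT-src b m e∈))) , (λ (e∈G , path) → closed e∈G path) }

-- Deleting the bridge leaves the two halves, of equal size, as components.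
bridge-imbalance : ∀ b p → Imb (BT b (suc p)) (b , b + 2 ^ p) 0
bridge-imbalance b p = BT b p , BT K p , lower-comp , upper-comp , sym (m≡n⇒∣m-n∣≡0 (BT-size-shift b K p))
  where
  K : ℕ
  K = b + 2 ^ p
  G′ : Graph
  G′ = removeE (b , K) (BT b (suc p))
  lower-comp : CompEdges G′ b (BT b p)
  lower-comp = BT-component b p (≤-refl , root<mid b p) (λ e∈ → ∈-removeE⁺ (lower⁺ b p e∈) (bridge∉lower b p e∈ ∘ sym)) closed
    where
    closed : ∀ {x y} → (x , y) ∈ G′ → Conn G′ b x → (x , y) ∈ BT b p
    closed e∈ path with ∈-removeE⁻ e∈
    ... | e∈G , e≢bridge with half b p e∈G
    ... | lower e∈L = e∈L
    ... | middle = contradiction refl e≢bridge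
    ... | upper e∈U = ⊥-elim (<⇒≱ (below-mid-closed b p path (root<mid b p)) (proj₁ (BT-src K p e∈U)))
  upper-comp : CompEdges G′ K (BT K p)
  upper-comp = BT-component K p (≤-refl , root<mid K p) (λ e∈ → ∈-removeE⁺ (upper⁺ b p e∈) (bridge∉upper b p e∈ ∘ sym)) closed
    where
    closed : ∀ {x y} → (x , y) ∈ G′ → Conn G′ K x → (x , y) ∈ BT K p
    closed e∈ path with ∈-removeE⁻ e∈
    ... | e∈G , e≢bridge with half b p e∈G
    ... | lower e∈L = ⊥-elim (<⇒≱ (proj₂ (BT-src b p e∈L)) (above-mid-closed b p path ≤-refl))
    ... | middle = contradiction refl e≢bridge
    ... | upper e∈U = e∈U

-- If Y is not joined to X in G′,
-- the component of Y lies in H minus (u , v), so it is shorter than that of X.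
smaller-side : ∀ {G H M u v h X Y LX LY} → let G′ = removeE (u , v) G in
    (∀ {e} → e ∈ G → e ∈ H ⊎ e ∈ M) → (u , v) ∈ H → length H < length M
  → Unique M → (∀ {e} → e ∈ M → e ∈ G′ × Conn G′ h (proj₁ e)) → Conn G′ h X
  → ¬ Conn G′ X Y → CompEdges G′ X LX → CompEdges G′ Y LY → length LY < length LX
smaller-side {G} {H} {M} {u} {v} {X = X} {LX = LX} {LY} cover e∈H H<M uniqueM reachM h~X X≁Y (_ , charX) (uniqueY , charY) =
  begin-strict
    length LY <⟨ unique-length-≤ (tabulate e∉LY ∷ uniqueY) e∷LY⊆H ⟩
    length H  <⟨ H<M ⟩
    length M  ≤⟨ unique-length-≤ uniqueM (λ e∈M → proj₂ (charX _) (from-X e∈M)) ⟩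
    length LX ∎
  where
  open ≤-Reasoning
  from-X : ∀ {e} → e ∈ M → e ∈ removeE (u , v) G × Conn (removeE (u , v) G) X (proj₁ e)
  from-X e∈M = let e∈G′ , h~e = reachM e∈M in e∈G′ , conn-sym h~X ◅◅ h~e
  e∉LY : ∀ {e} → e ∈ LY → (u , v) ≢ e
  e∉LY e∈LY eq = proj₂ (∈-removeE⁻ {G = G} (proj₁ (proj₁ (charY _) e∈LY))) (sym eq)
  e∷LY⊆H : (u , v) ∷ LY ⊆ H
  e∷LY⊆H (here refl) = e∈H
  e∷LY⊆H (there e∈LY) with proj₁ (charY _) e∈LY
  ... | e∈G′ , Y~e with cover (proj₁ (∈-removeE⁻ {G = G} e∈G′))
  ... | inj₁ e∈H′ = e∈H′
  ... | inj₂ e∈M = contradiction (proj₂ (from-X e∈M) ◅◅ conn-sym Y~e) X≁Y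

-- Consequently, if deleting (u , v) disconnects u from v and M is reached
-- in G′ from a vertex h joined to u in G, the two sides of (u , v) have
-- different sizes: take for X whichever endpoint h still reaches in G′.
unequal-sides : ∀ {G H M u v h L₁ L₂} → let G′ = removeE (u , v) G in
    (∀ {e} → e ∈ G → e ∈ H ⊎ e ∈ M) → (u , v) ∈ H → length H < length M
  → Unique M → (∀ {e} → e ∈ M → e ∈ G′ × Conn G′ h (proj₁ e)) → Conn G h u
  → ¬ Conn G′ u v → CompEdges G′ u L₁ → CompEdges G′ v L₂ → length L₁ ≢ length L₂
unequal-sides cover e∈H H<M uniqueM reachM h~u u≁v comp₁ comp₂ with conn-removeE h~u
... | inj₁ h~u′ = λ eq → <⇒≢ (smaller-side cover e∈H H<M uniqueM reachM h~u′ u≁v comp₁ comp₂) (sym eq)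
... | inj₂ (inj₁ h~u′) = λ eq → <⇒≢ (smaller-side cover e∈H H<M uniqueM reachM h~u′ u≁v comp₁ comp₂) (sym eq)
... | inj₂ (inj₂ h~v′) = <⇒≢ (smaller-side cover e∈H H<M uniqueM reachM h~v′ (u≁v ∘ conn-sym) comp₂ comp₁)

-- Every edge of BT b (suc p) other than the bridge is unbalanced: the other
-- half together with the bridge stays on one side.
non-bridge-unbalanced : ∀ b p {u v L₁ L₂} → (u , v) ∈ BT b (suc p) → (u , v) ≢ (b , b + 2 ^ p)
  → CompEdges (removeE (u , v) (BT b (suc p))) u L₁ → CompEdges (removeE (u , v) (BT b (suc p))) v L₂
  → length L₁ ≢ length L₂
non-bridge-unbalanced b p {u} {v} e∈ e≢bridge with half b p e∈
... | middle = contradiction refl e≢bridge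
... | lower e∈L = unequal-sides (∈-++⁻ (BT b p)) e∈L (s≤s (≤-reflexive (BT-size-shift b K p)))
                    (tabulate (bridge∉upper b p) ∷ BT-unique K p) reach
                    (BT-root-conn b (suc p) (BT-src b (suc p) e∈)) (BT-acyclic b (suc p) e∈)
  where
  K : ℕ
  K = b + 2 ^ p
  G′ : Graph
  G′ = removeE (u , v) (BT b (suc p))
  bridge∈G′ : (b , K) ∈ G′
  bridge∈G′ = ∈-removeE⁺ (middle⁺ b p) (e≢bridge ∘ sym)
  upper⊆G′ : BT K p ⊆ G′
  upper⊆G′ {_ , _} a∈U = ∈-removeE⁺ (upper⁺ b p a∈U)
    (λ eq → <⇒≱ (proj₂ (BT-src b p e∈L)) (subst (K ≤_) (cong proj₁ eq) (proj₁ (BT-src K p a∈U))))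
  reach : ∀ {e} → e ∈ (b , K) ∷ BT K p → e ∈ G′ × Conn G′ b (proj₁ e)
  reach (here refl) = bridge∈G′ , ε
  reach {_ , _} (there a∈U) = upper⊆G′ a∈U , inj₁ bridge∈G′ ◅ conn-mono upper⊆G′ (BT-root-conn K p (BT-src K p a∈U))
... | upper e∈U = unequal-sides cover e∈U (s≤s (≤-reflexive (BT-size-shift K b p)))
                    (tabulate (bridge∉lower b p) ∷ BT-unique b p) reach
                    (conn-mono (upper⁺ b p) (BT-root-conn K p (BT-src K p e∈U))) (BT-acyclic b (suc p) e∈)
  where
  K : ℕ
  K = b + 2 ^ p
  G′ : Graph
  G′ = removeE (u , v) (BT b (suc p))
  cover : ∀ {e} → e ∈ BT b (suc p) → e ∈ BT K p ⊎ e ∈ (b , K) ∷ BT b p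
  cover a∈ with half b p a∈
  ... | lower a∈L = inj₂ (there a∈L)
  ... | middle = inj₂ (here refl)
  ... | upper a∈U = inj₁ a∈U
  bridge∈G′ : (b , K) ∈ G′
  bridge∈G′ = ∈-removeE⁺ (middle⁺ b p) (e≢bridge ∘ sym)
  lower⊆G′ : BT b p ⊆ G′
  lower⊆G′ {_ , _} a∈L = ∈-removeE⁺ (lower⁺ b p a∈L)
    (λ eq → <⇒≱ (proj₂ (BT-src b p a∈L)) (subst (K ≤_) (sym (cong proj₁ eq)) (proj₁ (BT-src K p e∈U))))
  reach : ∀ {e} → e ∈ (b , K) ∷ BT b p → e ∈ G′ × Conn G′ K (proj₁ e)
  reach (here refl) = bridge∈G′ , inj₂ bridge∈G′ ◅ ε
  reach {_ , _} (there a∈L) = lower⊆G′ a∈L , inj₂ bridge∈G′ ◅ conn-mono lower⊆G′ (BT-root-conn b p (BT-src b p a∈L))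

bridge-balanced : ∀ b p {C} → SameEdges C (BT b (suc p)) → Balanced C (b , b + 2 ^ p)
bridge-balanced b p (C⊆BT , BT⊆C) =
  BT⊆C (middle⁺ b p) , 0 , imb-same (BT⊆C , C⊆BT) (bridge-imbalance b p) , λ _ _ _ _ → z≤n

balanced-is-bridge : ∀ b p {e} → Balanced (BT b (suc p)) e → e ≡ (b , b + 2 ^ p)
balanced-is-bridge b p {e} (e∈ , d , (L₁ , L₂ , comp₁ , comp₂ , d≡) , minimal) with e ≟ₑ (b , b + 2 ^ p)
... | yes e≡bridge = e≡bridge
... | no e≢bridge = ⊥-elim (non-bridge-unbalanced b p e∈ e≢bridge comp₁ comp₂ (∣m-n∣≡0⇒m≡n (trans (sym d≡) d≡0)))
  where
  d≡0 : d ≡ 0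
  d≡0 = n≤0⇒n≡0 (minimal _ 0 (middle⁺ b p) (bridge-imbalance b p))

InBlocks : ℕ → ℕ → Edge → Set
InBlocks N m e = ∃[ c ] (c < N × e ∈ BT (c * 2 ^ m) m)

record BlockForest (N m : ℕ) (F : Graph) : Set where
  constructor blockForest
  field
    inBlocks : ∀ {e} → e ∈ F → InBlocks N m e
    blocks⊆  : ∀ {c} → c < N → BT (c * 2 ^ m) m ⊆ F

open BlockForest

block-end≤ : ∀ M {d d′} → d < d′ → d * M + M ≤ d′ * M
block-end≤ M {d} {d′} d<d′ = subst (_≤ d′ * M) (+-comm M (d * M)) (*-monoˡ-≤ M d<d′)

block-index-unique : ∀ m c c′ {x} → InRange (c * 2 ^ m) m x → InRange (c′ * 2 ^ m) m x → c ≡ c′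
block-index-unique m c c′ (lo , hi) (lo′ , hi′) with <-cmp c c′
... | tri≈ _ c≡c′ _ = c≡c′
... | tri< c<c′ _ _ = contradiction (≤-trans (block-end≤ (2 ^ m) c<c′) lo′) (<⇒≱ hi)
... | tri> _ _ c′<c = contradiction (≤-trans (block-end≤ (2 ^ m) c′<c) lo) (<⇒≱ hi′)

block-of : ∀ m x → ∃[ q ] InRange (q * 2 ^ m) m x
block-of m x = x / 2 ^ m , m/n*n≤m x (2 ^ m) , x<end
  where
  instance
    2^m≢0 : NonZero (2 ^ m)
    2^m≢0 = >-nonZero (2^-pos m)
  x<end : x < x / 2 ^ m * 2 ^ m + 2 ^ m
  x<end = begin-strict
    x                               ≡⟨ m≡m%n+[m/n]*n x (2 ^ m) ⟩
    x % 2 ^ m + x / 2 ^ m * 2 ^ m   <⟨ +-monoˡ-< (x / 2 ^ m * 2 ^ m) (m%n<n x (2 ^ m)) ⟩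
    2 ^ m + x / 2 ^ m * 2 ^ m       ≡⟨ +-comm (2 ^ m) _ ⟩
    x / 2 ^ m * 2 ^ m + 2 ^ m       ∎
    where open ≤-Reasoning

block-closed : ∀ {N m F} → BlockForest N m F → ∀ c {x y} → Conn F x y → InRange (c * 2 ^ m) m x → InRange (c * 2 ^ m) m y
block-closed {m = m} {F} forest c = conn-invariant (InRange (c * 2 ^ m) m) same-block
  where
  same-block : EdgeInvariant F (InRange (c * 2 ^ m) m)
  same-block {a} {d} e∈ with inBlocks forest e∈
  ... | c′ , _ , e∈T = let a∈ , d∈ = BT-range _ m e∈T in
    (λ a∈c → subst (λ z → InRange (z * 2 ^ m) m d) (sym (block-index-unique m c c′ a∈c a∈)) d∈) ,
    (λ d∈c → subst (λ z → InRange (z * 2 ^ m) m a) (sym (block-index-unique m c c′ d∈c d∈)) a∈)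

block-component : ∀ {N m F c x} → BlockForest N m F → c < N → InRange (c * 2 ^ m) m x → CompEdges F x (BT (c * 2 ^ m) m)
block-component {m = m} {F} {c} {x} forest c<N x∈ = BT-component _ m x∈ (blocks⊆ forest c<N) closed
  where
  closed : ∀ {a d} → (a , d) ∈ F → Conn F x a → (a , d) ∈ BT (c * 2 ^ m) m
  closed e∈ path with inBlocks forest e∈
  ... | c′ , _ , e∈T = subst (λ z → _ ∈ BT (z * 2 ^ m) m)
                         (sym (block-index-unique m c c′ (block-closed forest c path x∈) (BT-src _ m e∈T))) e∈T

components-agree : ∀ {G a L L′} → CompEdges G a L → CompEdges G a L′ → SameEdges L L′
components-agree (_ , char) (_ , char′) =
  (λ e∈L → proj₂ (char′ _) (proj₁ (char _) e∈L)) , (λ e∈L′ → proj₂ (char _) (proj₁ (char′ _) e∈L′))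

bridge : ℕ → ℕ → Edge
bridge c p = (c * 2 ^ suc p , c * 2 ^ suc p + 2 ^ p)

bridges : ℕ → ℕ → Graph
bridges N p = applyUpTo (λ c → bridge c p) N

bridge-in-block : ∀ c p → InRange (c * 2 ^ suc p) (suc p) (c * 2 ^ suc p)
bridge-in-block c p = ≤-refl , m<m+n _ (2^-pos (suc p))

-- The halves of block c of order p + 1 are the blocks 2c and 2c + 1 of order p.
lower-base : ∀ c p → c * 2 ^ suc p ≡ 2 * c * 2 ^ p
lower-base c p = trans (sym (*-assoc c 2 (2 ^ p))) (cong (_* 2 ^ p) (*-comm c 2))

upper-base : ∀ c p → c * 2 ^ suc p + 2 ^ p ≡ suc (2 * c) * 2 ^ p
upper-base c p = trans (+-comm (c * 2 ^ suc p) (2 ^ p)) (cong (2 ^ p +_) (lower-base c p))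

half-in-block : ∀ c p {x y} → (x , y) ∈ BT (c * 2 ^ suc p) p ⊎ (x , y) ∈ BT (c * 2 ^ suc p + 2 ^ p) p
              → InRange (c * 2 ^ suc p) (suc p) x
half-in-block c p (inj₁ e∈L) = lower-range _ p (BT-src _ p e∈L)
half-in-block c p (inj₂ e∈U) = upper-range _ p (BT-src _ p e∈U)

half-not-bridge : ∀ c p {e} → e ∈ BT (c * 2 ^ suc p) p ⊎ e ∈ BT (c * 2 ^ suc p + 2 ^ p) p → ∀ d → e ≢ bridge d p
half-not-bridge c p e∈half d refl with block-index-unique (suc p) c d (half-in-block c p e∈half) (bridge-in-block d p)
... | refl with e∈half
...   | inj₁ e∈L = bridge∉lower _ p e∈L refl
...   | inj₂ e∈U = bridge∉upper _ p e∈U refl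

bridges-valid : ∀ {N p F} → BlockForest N (suc p) F → ValidDeletion F (bridges N p)
bridges-valid {N} {p} {F} forest = balanced , covering , one-per-component
  where
  balanced : ∀ s → s ∈ bridges N p → ∀ C → CompEdges F (proj₁ s) C → Balanced C s
  balanced s s∈ C comp with ∈-applyUpTo⁻ (λ c → bridge c p) s∈
  ... | c , c<N , refl = bridge-balanced _ p (components-agree comp (block-component forest c<N (bridge-in-block c p)))
  covering : ∀ e → e ∈ F → ∃[ s ] (s ∈ bridges N p × Conn F (proj₁ e) (proj₁ s))
  covering (x , y) e∈ with inBlocks forest e∈
  ... | c , c<N , e∈T = bridge c p , ∈-applyUpTo⁺ (λ c → bridge c p) c<N ,
    conn-mono (blocks⊆ forest c<N) (BT-conn _ (suc p) (BT-src _ (suc p) e∈T) (bridge-in-block c p))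
  one-per-component : ∀ s s′ → s ∈ bridges N p → s′ ∈ bridges N p → Conn F (proj₁ s) (proj₁ s′) → s ≡ s′
  one-per-component s s′ s∈ s′∈ path with ∈-applyUpTo⁻ (λ c → bridge c p) s∈ | ∈-applyUpTo⁻ (λ c → bridge c p) s′∈
  ... | c , _ , refl | c′ , _ , refl = cong (λ z → bridge z p)
    (block-index-unique (suc p) c c′ (block-closed forest c path (bridge-in-block c p)) (bridge-in-block c′ p))

-- Conversely, a valid iteration deletes only bridges: a deleted edge (u , v)
-- is balanced in the component of u, which is the block of u, or is empty
-- when u lies in no block ...
deleted-are-bridges : ∀ {N p F S} → BlockForest N (suc p) F → ValidDeletion F S → S ⊆ bridges N p
deleted-are-bridges {N} {p} {F} {S} forest (balanced , _ , _) {u , v} s∈ with block-of (suc p) u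
... | q , u∈q with q <? N
...   | yes q<N = subst (_∈ bridges N p) (sym s≡bridge) (∈-applyUpTo⁺ (λ c → bridge c p) q<N)
  where
  s≡bridge : (u , v) ≡ bridge q p
  s≡bridge = balanced-is-bridge _ p (balanced (u , v) s∈ _ (block-component forest q<N u∈q))
...   | no q≮N = contradiction (proj₁ (balanced (u , v) s∈ [] isolated)) (λ ())
  where
  isolated : CompEdges F u []
  isolated = [] , λ e → (λ ()) , λ { (e∈F , path) → reached e∈F path }
    where
    reached : ∀ {e} → e ∈ F → Conn F u (proj₁ e) → e ∈ []
    reached {_ , _} e∈F path with inBlocks forest e∈F
    ... | c , c<N , e∈T = contradiction (subst (_< N) c≡q c<N) q≮N
      where
      c≡q : c ≡ q
      c≡q = block-index-unique (suc p) c q (block-closed forest c (conn-sym path) (BT-src _ (suc p) e∈T)) u∈q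

bridges-are-deleted : ∀ {N p F S} → BlockForest N (suc p) F → ValidDeletion F S → bridges N p ⊆ S
bridges-are-deleted {N} {p} {F} {S} forest valid@(_ , covering , _) b∈ with ∈-applyUpTo⁻ (λ c → bridge c p) b∈
... | c , c<N , refl with covering (bridge c p) (blocks⊆ forest c<N (middle⁺ _ p))
...   | s , s∈ , path with ∈-applyUpTo⁻ (λ c → bridge c p) (deleted-are-bridges forest valid s∈)
...     | d , _ , refl = subst (λ z → bridge z p ∈ S)
            (block-index-unique (suc p) d c (bridge-in-block d p) (block-closed forest c path (bridge-in-block c p))) s∈

even-or-odd : ∀ n → ∃[ c ] (n ≡ 2 * c ⊎ n ≡ suc (2 * c))
even-or-odd zero = 0 , inj₁ refl
even-or-odd (suc n) with even-or-odd n
... | c , inj₁ refl = c , inj₂ refl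
... | c , inj₂ refl = suc c , inj₁ (sym (*-suc 2 c))

2c+1<2N : ∀ {c N} → c < N → suc (2 * c) < 2 * N
2c+1<2N {c} {N} c<N = subst (_≤ 2 * N) (*-suc 2 c) (*-monoʳ-≤ 2 c<N)

delete-bridges : ∀ {N p F S} → BlockForest N (suc p) F → S ⊆ bridges N p → bridges N p ⊆ S
               → BlockForest (2 * N) p (removeAll S F)
delete-bridges {N} {p} {F} {S} forest S⊆bridges bridges⊆S = blockForest edges-in-blocks blocks-kept
  where
  edges-in-blocks : ∀ {e} → e ∈ removeAll S F → InBlocks (2 * N) p e
  edges-in-blocks {e} e∈ with ∈-removeAll⁻ {S} e∈
  ... | e∈F , e∉S with inBlocks forest e∈F
  ... | c , c<N , e∈T with half _ p e∈T
  ... | lower e∈L = 2 * c , *-monoʳ-< 2 c<N , subst (λ z → e ∈ BT z p) (lower-base c p) e∈L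
  ... | middle = contradiction (bridges⊆S (∈-applyUpTo⁺ (λ c → bridge c p) c<N)) e∉S
  ... | upper e∈U = suc (2 * c) , 2c+1<2N c<N , subst (λ z → e ∈ BT z p) (upper-base c p) e∈U
  keep : ∀ {c e} → c < N → e ∈ BT (c * 2 ^ suc p) p ⊎ e ∈ BT (c * 2 ^ suc p + 2 ^ p) p → e ∈ removeAll S F
  keep {c} c<N e∈half = ∈-removeAll⁺ {S} (blocks⊆ forest c<N (Sum.[ lower⁺ _ p , upper⁺ _ p ] e∈half)) e∉S
    where
    e∉S : _ ∉ S
    e∉S e∈S with ∈-applyUpTo⁻ (λ c → bridge c p) (S⊆bridges e∈S)
    ... | d , _ , e≡bridge = half-not-bridge c p e∈half d e≡bridge
  blocks-kept : ∀ {c′} → c′ < 2 * N → BT (c′ * 2 ^ p) p ⊆ removeAll S F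
  blocks-kept {c′} c′<2N {e} e∈ with even-or-odd c′
  ... | c , inj₁ refl = keep (*-cancelˡ-< 2 c N c′<2N) (inj₁ (subst (λ z → e ∈ BT z p) (sym (lower-base c p)) e∈))
  ... | c , inj₂ refl = keep (*-cancelˡ-< 2 c N (<-trans (n<1+n _) c′<2N)) (inj₂ (subst (λ z → e ∈ BT z p) (sym (upper-base c p)) e∈))

block-forest-empty : ∀ {N F} → BlockForest N 0 F → F ≡ []
block-forest-empty {F = []} _ = refl
block-forest-empty {F = e ∷ F} forest with inBlocks forest (here refl)
... | _ , _ , ()

bridge₀∈ : ∀ {N p F} → 0 < N → BlockForest N (suc p) F → bridge 0 p ∈ F
bridge₀∈ {p = p} 0<N forest = blocks⊆ forest 0<N (middle⁺ 0 p)

-- Deleting all bridges at every step is a run with m iterations ...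
run-exists : ∀ m {N F} → 0 < N → BlockForest N m F → Run F m
run-exists zero _ forest rewrite block-forest-empty forest = done
run-exists (suc p) {N} 0<N forest =
  step (bridges N p) (_ , bridge₀∈ 0<N forest) (bridges-valid forest)
       (run-exists p (*-monoʳ-< 2 0<N) (delete-bridges forest id id))

-- ... and every run has m iterations, since each iteration must delete
-- exactly the bridges.
run-empty : ∀ {n} → Run [] n → n ≡ 0
run-empty done = refl
run-empty (step _ (_ , ()) _ _)

run-length : ∀ m {N F n} → 0 < N → BlockForest N m F → Run F n → n ≡ m
run-length zero _ forest run rewrite block-forest-empty forest = run-empty run
run-length (suc p) 0<N forest done with () ← bridge₀∈ 0<N forest
run-length (suc p) 0<N forest (step S _ valid run) =
  cong suc (run-length p (*-monoʳ-< 2 0<N)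
    (delete-bridges forest (deleted-are-bridges forest valid) (bridges-are-deleted forest valid)) run)

-- binEdges m, the edge list of B_(m+1), is BT 0 m, because shifting BT b m
-- by s gives BT (s + b) m.
shift-BT : ∀ s b m → map (shiftE s) (BT b m) ≡ BT (s + b) m
shift-BT s b zero = refl
shift-BT s b (suc p) = begin
  map (shiftE s) (BT b p ++ ((b , b + 2 ^ p) ∷ BT (b + 2 ^ p) p))
    ≡⟨ map-++ (shiftE s) (BT b p) _ ⟩
  map (shiftE s) (BT b p) ++ ((s + b , s + (b + 2 ^ p)) ∷ map (shiftE s) (BT (b + 2 ^ p) p))
    ≡⟨ cong₂ (λ L R → L ++ ((s + b , R) ∷ map (shiftE s) (BT (b + 2 ^ p) p))) (shift-BT s b p) (sym (+-assoc s b (2 ^ p))) ⟩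
  BT (s + b) p ++ ((s + b , s + b + 2 ^ p) ∷ map (shiftE s) (BT (b + 2 ^ p) p))
    ≡⟨ cong (λ U → BT (s + b) p ++ ((s + b , s + b + 2 ^ p) ∷ U))
            (trans (shift-BT s (b + 2 ^ p) p) (cong (λ t → BT t p) (sym (+-assoc s b (2 ^ p))))) ⟩
  BT (s + b) (suc p) ∎
  where open ≡-Reasoning

binEdges≡BT : ∀ m → binEdges m ≡ BT 0 m
binEdges≡BT zero = refl
binEdges≡BT (suc p) = cong₂ (λ L U → L ++ ((0 , 2 ^ p) ∷ U)) (binEdges≡BT p)
  (trans (cong (map (shiftE (2 ^ p))) (binEdges≡BT p))
         (trans (shift-BT (2 ^ p) 0 p) (cong (λ t → BT t p) (+-identityʳ (2 ^ p)))))

B-block-forest : ∀ m → BlockForest 1 m (B (suc m))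
B-block-forest m = blockForest (λ e∈ → 0 , s≤s z≤n , subst (_ ∈_) (binEdges≡BT m) e∈) single-block
  where
  single-block : ∀ {c} → c < 1 → BT (c * 2 ^ m) m ⊆ B (suc m)
  single-block (s≤s z≤n) = subst (_ ∈_) (sym (binEdges≡BT m))

lemma3p3 : (k : ℕ) → 2 ≤ k
         → (∃[ n ] Run (B k) n) × (∀ n → Run (B k) n → n ≡ k ∸ 1)
lemma3p3 (suc zero) (s≤s ())
lemma3p3 (suc (suc q)) _ =
    (suc q , run-exists (suc q) 0<1 (B-block-forest (suc q)))
  , λ n run → run-length (suc q) 0<1 (B-block-forest (suc q)) run
  where
  0<1 : 0 < 1
  0<1 = s≤s z≤n
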